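{- Let $\mathcal{F}$ be a maximal intersecting subfamily of $\mathcal{P}([n])$ and let $A$ be an inclusion-minimal set of $\mathcal{F}$ such that $\{|A|, n-|A|\} \neq \{\lfloor n/2 \rfloor, \lceil n/2 \rceil\}$. Define \[ \mathcal{G} = \big(\{B \subseteq [n+1] : B \cap [n] \in \mathcal{F}\} \setminus \{A\}\big) \cup \{[n+1]\setminus A\}. \] Then $\mathcal{G}$, regarded as a family in $\mathcal{P}([n+1])$, is not $\emptyset$-minimal.
   Context: $[m] = \{1,\dots,m\}$, $\mathcal{P}([m])$ the power set, $\oplus$ symmetric difference. A family is intersecting if any two members intersect; a maximal intersecting subfamily of $\mathcal{P}([n])$ is one not properly contained in another intersecting subfamily. For a family $\mathcal{K} \subseteq \mathcal{P}([m])$, $\mathcal{K}^* = \{[m]\setminus X : X \in \mathcal{K}\}$. Let $\Sigma_m$ be the set of permutations of $[m]$; for $\sigma \in \Sigma_m$, $X \subseteq [m]$ let $P^{\sigma,X}_0 = X$, $P^{\sigma,X}_k = P^{\sigma,X}_{k-1} \oplus \{\sigma(k)\}$ ($k \in [m]$). Define $\Lambda(\mathcal{K}) \in \mathbb{R}^{\mathcal{P}([m])\times\mathcal{P}([m])}$ by $\Lambda(\mathcal{K}) = \sum_{\sigma\in\Sigma_m}\sum_{X \in \mathcal{K}}\sum_{k\in[m]} ( e_{(P^{\sigma,X}_{k-1}, P^{\sigma,X}_k)} - e_{(P^{\sigma,X}_k, P^{\sigma,X}_{k-1})})$, where $e_{(Y,Z)}$ is the standard basis. A family $\mathcal{K}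 \subseteq \mathcal{P}([m])$ is called $\emptyset$-minimal if for every $a \in [m]$, $\Lambda(\mathcal{K}^*)_{(\emptyset, \{a\})} = \min\{\Lambda(\mathcal{K}^*)_{(B, B\cup\{a\})} : B \subseteq [m]\setminus\{a\}\}$. Here the ground set for $\mathcal{G}$ is $[m] = [n+1]$. -}

module Defs where

open import Data.Bool using (Bool; true; false; if_then_else_; _∧_; not)
open import Data.Nat using (ℕ; zero; suc; _∸_; _/_)
open import Data.Nat.Base using (⌊_/2⌋; ⌈_/2⌉)
open import Data.Integer using (ℤ; _+_; _-_; _≤_) renaming (+_ to ⁺)
open import Data.Fin using (Fin; inject₁; fromℕ; _≟_)
open import Data.Fin.Subset using (Subset; _∩_; _∈_; _∉_; _⊆_; ∁; ⁅_⁆; ⊥; ∣_∣; Nonempty; _∪_)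
open import Data.Vec using (Vec; []; _∷_; lookup; tabulate; _∷ʳ_)
import Data.Vec.Properties as VP
import Data.Bool.Properties as BP
open import Data.List using (List; []; _∷_; map; concatMap; filter; foldr; allFin)
open import Relation.Binary.PropositionalEquality using (_≡_)
open import Relation.Nullary using (¬_; does)
open import Relation.Nullary.Decidable using (⌊_⌋)
open import Data.Product using (_×_; Σ; ∃)
open import Data.Sum using (_⊎_)

Family : ℕ → Set
Family m = Subset m → Bool

_∈F_ : ∀ {m} → Subset m → Family m → Set
X ∈F 𝒦 = 𝒦 X ≡ true

_⊆F_ : ∀ {m} → Family m → Family m → Set
𝒦 ⊆F ℒ = ∀ X → X ∈F 𝒦 → X ∈F ℒ

Intersecting : ∀ {m} → Family m → Set
Intersecting 𝒦 = ∀ X Y → X ∈F 𝒦 → Y ∈F 𝒦 → Nonempty (X ∩ Y)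

MaximalIntersecting : ∀ {m} → Family m → Set
MaximalIntersecting 𝒦 =
  Intersecting 𝒦 × (∀ ℒ → Intersecting ℒ → 𝒦 ⊆F ℒ → ℒ ⊆F 𝒦)

InclusionMinimalIn : ∀ {m} → Subset m → Family m → Set
InclusionMinimalIn A 𝒦 = A ∈F 𝒦 × (∀ B → B ∈F 𝒦 → B ⊆ A → B ≡ A)

_* : ∀ {m} → Family m → Family m
(𝒦 *) X = 𝒦 (∁ X)

SetEq₂ : ℕ → ℕ → ℕ → ℕ → Set
SetEq₂ a b c d = ((a ≡ c ⊎ a ≡ d) × (b ≡ c ⊎ b ≡ d))
               × ((c ≡ a ⊎ c ≡ b) × (d ≡ a ⊎ d ≡ b))

allVecs : ∀ {A : Set} → List A → (k : ℕ) → List (Vec A k)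
allVecs xs zero    = [] ∷ []
allVecs xs (suc k) = concatMap (λ x → map (x ∷_) (allVecs xs k)) xs

allSubsets : (m : ℕ) → List (Subset m)
allSubsets m = allVecs (true ∷ false ∷ []) m

_==F_ : ∀ {m} → Fin m → Fin m → Bool
i ==F j = ⌊ i ≟ j ⌋

_==S_ : ∀ {m} → Subset m → Subset m → Bool
X ==S Y = ⌊ VP.≡-dec BP._≟_ X Y ⌋

allB : ∀ {A : Set} → (A → Bool) → List A → Bool
allB p = foldr (λ x b → p x ∧ b) true

-- a vector σ = (σ(1),…,σ(m)) is (the table of) a permutation iff injective
isPerm : ∀ {m} → Vec (Fin m) m → Bool
isPerm {m} σ = allB (λ i → allB (λ j →
  if lookup σ i ==F lookup σ j then i ==F j else true) (allFin m)) (allFin m)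

Perms : (m : ℕ) → List (Vec (Fin m) m)
Perms m = filter (λ σ → isPerm σ ≟B true) (allVecs (allFin m) m)
  where
  _≟B_ = BP._≟_

sumℤ : ∀ {A : Set} → (A → ℤ) → List A → ℤ
sumℤ f = foldr (λ x s → f x + s) (⁺ 0)

toggle : ∀ {m} → Subset m → Fin m → Subset m
toggle P i = tabulate (λ j → if j ==F i then not (lookup P j) else lookup P j)

[_] : Bool → ℤ
[ true ]  = ⁺ 1
[ false ] = ⁺ 0

-- Given P_{k-1} and the remaining values σ(k), σ(k+1), …, σ(m),
-- the sum over those k of the (Y , Z)-entry of
-- e_(P_{k-1}, P_k) - e_(P_k, P_{k-1}).
walk : ∀ {m l} → Subset m → Subset m → Subset m → Vec (Fin m) l → ℤ
walk Y Z P []      = ⁺ 0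
walk Y Z P (s ∷ σ) =
  let P' = toggle P s in
  ([ (P ==S Y) ∧ (P' ==S Z) ] - [ (P' ==S Y) ∧ (P ==S Z) ]) + walk Y Z P' σ

Λ : ∀ {m} → Family m → Subset m → Subset m → ℤ
Λ {m} 𝒦 Y Z =
  sumℤ (λ σ → sumℤ (λ X → if 𝒦 X then walk Y Z X σ else ⁺ 0) (allSubsets m))
       (Perms m)

IsMinOverB : ∀ {m} → Family m → Fin m → ℤ → Set
IsMinOverB 𝒦 a x =
  (∃ λ B → (a ∉ B) × (Λ (𝒦 *) B (B ∪ ⁅ a ⁆) ≡ x))
  × (∀ B → a ∉ B → x ≤ Λ (𝒦 *) B (B ∪ ⁅ a ⁆))

∅-minimal : ∀ {m} → Family m → Set
∅-minimal 𝒦 = ∀ a → IsMinOverB 𝒦 a (Λ (𝒦 *) ⊥ ⁅ a ⁆)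

-- The construction of 𝒢 ⊆ 𝒫([n+1]).  Element n+1 is the last index
-- (fromℕ n); [n] is embedded via inject₁.

restrict : ∀ {n} → Subset (suc n) → Subset n
restrict B = tabulate (λ i → lookup B (inject₁ i))

lift : ∀ {n} → Subset n → Subset (suc n)
lift A = A ∷ʳ false

𝒢 : ∀ {n} → Family n → Subset n → Family (suc n)
𝒢 ℱ A B = (ℱ (restrict B) ∧ not (B ==S lift A)) Data.Bool.∨ (B ==S ∁ (lift A))

-- Put a = n + 1 and let Y ⊆ [n]. A walk from X along a permutation σ can cross the edge between Y and
-- Y ∪ {a} only at the step that toggles a. If a ∉ X it crosses forwards exactly when the elements
-- toggled before a form X ⊕ Y, which happens for d! (n − d)! permutations, d = |X ⊕ Y|, and the walks
-- from X ∪ {a} contribute the negative. In 𝒢* the sets X and X ∪ {a} therefore cancel in pairs, except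
-- for A and [n] ∖ A (as ℱ is intersecting, [n] ∖ A ∉ ℱ), so Λ(𝒢*)_(Y, Y ∪ {a}) = 2 k! (n − k)! with
-- k = |A ⊕ Y|. At Y = ∅ this is 2 |A|! (n − |A|)!, which exceeds the value 2 ⌊n/2⌋! ⌈n/2⌉! at any Y
-- with |A ⊕ Y| = ⌊n/2⌋ unless |A| ∈ {⌊n/2⌋, ⌈n/2⌉}.

module Submission where

open import Defs
open import Data.Nat using (ℕ; _∸_; ⌊_/2⌋; ⌈_/2⌉)
open import Data.Fin.Subset using (Subset; ∣_∣)
open import Relation.Nullary using (¬_)

open import Data.Bool using (Bool; true; false; not; _∧_; _∨_; _xor_; if_then_else_)
import Data.Bool.Properties as BP
open import Data.Nat as ℕ using (zero; suc; _!)
import Data.Nat.Properties as ℕP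
open import Data.Integer as ℤ using (ℤ; 0ℤ; _+_; _-_; -_; _*_) renaming (+_ to ⁺)
import Data.Integer.Properties as ℤP
open import Data.Fin as F using (Fin; fromℕ)
import Data.Fin.Properties as FP
import Data.Fin.Subset as S
open S using (_∪_; ∁; ⁅_⁆; ⊤)
import Data.Fin.Subset.Properties as SP
open import Data.Vec as V using (Vec; []; _∷_; lookup; tabulate; _∷ʳ_)
import Data.Vec.Properties as VP
open import Data.List as L using (List; []; _∷_; allFin; concatMap)
open import Data.Product using (Σ; _,_; proj₁; proj₂; _×_)
open import Data.Sum using (_⊎_; inj₁; inj₂)
open import Function using (_∘_)
open import Function.Bundles using (_⇔_; mk⇔)
open import Function.Definitions using (Injective)
import Function.Properties.Equivalence as ⇔
open import Relation.Binary.Definitions using (tri<; tri≈; tri>)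
open import Relation.Binary.PropositionalEquality
  using (_≡_; _≢_; _≗_; refl; sym; trans; cong; cong₂; subst; subst₂; module ≡-Reasoning)
open import Relation.Nullary using (Dec; yes; no; contradiction)
open import Relation.Nullary.Decidable
  using (isYes; isYes≗does; does-⇔; dec-true; dec-false; ⌊⌋-map′; decidable-stable)
open import Algebra.Properties.Semiring.Sum ℤP.+-*-semiring
  using (sum-syntax; sum-cong-≗; ∑-distrib-+; sum-replicate-zero)
open import Algebra.Properties.CommutativeSemigroup ℤP.+-commutativeSemigroup using (interchange)
open import Algebra.Properties.AbelianGroup ℤP.+-0-abelianGroup using (⁻¹-anti-homo‿-)

==F-refl : ∀ {m} (i : Fin m) → (i ==F i) ≡ true
==F-refl i = trans (isYes≗does (i F.≟ i)) (dec-true (i F.≟ i) refl)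

==F-≢ : ∀ {m} {i j : Fin m} → i ≢ j → (i ==F j) ≡ false
==F-≢ {i = i} {j} i≢j = trans (isYes≗does (i F.≟ j)) (dec-false (i F.≟ j) i≢j)

suc-==F : ∀ {m} (i j : Fin m) → (F.suc i ==F F.suc j) ≡ (i ==F j)
suc-==F i j = ⌊⌋-map′ _ _ (i F.≟ j)

==F⇒≡ : ∀ {m} {i j : Fin m} → (i ==F j) ≡ true → i ≡ j
==F⇒≡ {i = i} {j} e with i F.≟ j
... | yes i≡j = i≡j

==S-refl : ∀ {m} (X : Subset m) → (X ==S X) ≡ true
==S-refl X = trans (isYes≗does (VP.≡-dec BP._≟_ X X)) (dec-true (VP.≡-dec BP._≟_ X X) refl)

==S-≢ : ∀ {m} {X Y : Subset m} → X ≢ Y → (X ==S Y) ≡ false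
==S-≢ {X = X} {Y} X≢Y = trans (isYes≗does (VP.≡-dec BP._≟_ X Y)) (dec-false (VP.≡-dec BP._≟_ X Y) X≢Y)

==S-⇔ : ∀ {k l} {v u : Subset k} {v' u' : Subset l} → (v ≡ u ⇔ v' ≡ u') → (v ==S u) ≡ (v' ==S u')
==S-⇔ {v = v} {u} {v'} {u'} v≡u⇔v'≡u' = trans (isYes≗does (VP.≡-dec BP._≟_ v u))
  (trans (does-⇔ v≡u⇔v'≡u' (VP.≡-dec BP._≟_ v u) (VP.≡-dec BP._≟_ v' u'))
         (sym (isYes≗does (VP.≡-dec BP._≟_ v' u'))))

==S-∷ : ∀ {n} b (v u : Subset n) → ((b ∷ v) ==S (b ∷ u)) ≡ (v ==S u)
==S-∷ b v u = ==S-⇔ (mk⇔ VP.∷-injectiveʳ (cong (b ∷_)))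

==S-∷ʳ : ∀ {n} (v u : Subset n) b → ((v ∷ʳ b) ==S (u ∷ʳ b)) ≡ (v ==S u)
==S-∷ʳ v u b = ==S-⇔ (mk⇔ (VP.∷ʳ-injectiveˡ v u) (cong (_∷ʳ b)))

==S-∷ʳ-≢ : ∀ {n} (v u : Subset n) {b c} → b ≢ c → ((v ∷ʳ b) ==S (u ∷ʳ c)) ≡ false
==S-∷ʳ-≢ v u b≢c = ==S-≢ (b≢c ∘ VP.∷ʳ-injectiveʳ v u)

[==S∧==S]≡0 : ∀ {m} {X X' W W' : Subset m} → (X ≡ X' → W ≢ W') → [ (X ==S X') ∧ (W ==S W') ] ≡ 0ℤ
[==S∧==S]≡0 {X = X} {X'} {W} {W'} h with VP.≡-dec BP._≟_ X X' | VP.≡-dec BP._≟_ W W'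
... | yes X≡X' | yes W≡W' = contradiction W≡W' (h X≡X')
... | yes _    | no _     = refl
... | no _     | _        = refl

∧-≡-true : ∀ {b c} → b ∧ c ≡ true → b ≡ true × c ≡ true
∧-≡-true {true} {true} _ = refl , refl

xor-≢ : ∀ {b c} → b ≢ c → b xor c ≡ true
xor-≢ {true}  {true}  b≢c = contradiction refl b≢c
xor-≢ {true}  {false} _   = refl
xor-≢ {false} {true}  _   = refl
xor-≢ {false} {false} b≢c = contradiction refl b≢c

xor-≡ : ∀ {b c} → b ≡ c → b xor c ≡ false
xor-≡ {b} refl = BP.xor-same b

≢⇒not≡ : ∀ {b c} → b ≢ c → not b ≡ c
≢⇒not≡ {true}  {true}  b≢c = contradiction refl b≢c
≢⇒not≡ {true}  {false} _   = refl
≢⇒not≡ {false} {true}  _   = refl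
≢⇒not≡ {false} {false} b≢c = contradiction refl b≢c

lookup-≗⇒≡ : ∀ {A : Set} {m} {xs ys : Vec A m} → lookup xs ≗ lookup ys → xs ≡ ys
lookup-≗⇒≡ {xs = xs} {ys} h = begin
  xs                  ≡⟨ VP.tabulate∘lookup xs ⟨
  tabulate (lookup xs) ≡⟨ VP.tabulate-cong h ⟩
  tabulate (lookup ys) ≡⟨ VP.tabulate∘lookup ys ⟩
  ys                  ∎
  where open ≡-Reasoning

lookup-⁅⁆ : ∀ {m} (a j : Fin m) → lookup ⁅ a ⁆ j ≡ (j ==F a)
lookup-⁅⁆ a j with j F.≟ a
... | yes refl = VP.[]=⇒lookup (SP.x∈⁅x⁆ a)
... | no j≢a with lookup ⁅ a ⁆ j in e
...   | true  = contradiction (SP.x∈⁅y⁆⇒x≡y a (VP.lookup⇒[]= j _ e)) j≢a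
...   | false = refl

lookup-toggle : ∀ {m} (P : Subset m) i j → lookup (toggle P i) j ≡ (j ==F i) xor lookup P j
lookup-toggle P i j = trans (VP.lookup∘tabulate _ j) (if-not (j ==F i))
  where
  if-not : ∀ b {x} → (if b then not x else x) ≡ b xor x
  if-not true  = refl
  if-not false = refl

lookup-toggle-self : ∀ {m} (P : Subset m) i → lookup (toggle P i) i ≡ not (lookup P i)
lookup-toggle-self P i = trans (lookup-toggle P i i) (cong (_xor lookup P i) (==F-refl i))

lookup-toggle-other : ∀ {m} (P : Subset m) {i j} → j ≢ i → lookup (toggle P i) j ≡ lookup P j
lookup-toggle-other P {i} {j} j≢i = trans (lookup-toggle P i j) (cong (_xor lookup P j) (==F-≢ j≢i))

toggle-comm : ∀ {m} (P : Subset m) i j → toggle (toggle P i) j ≡ toggle (toggle P j) i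
toggle-comm P i j = lookup-≗⇒≡ λ k → begin
  lookup (toggle (toggle P i) j) k      ≡⟨ lookup-toggle (toggle P i) j k ⟩
  (k ==F j) xor lookup (toggle P i) k   ≡⟨ cong ((k ==F j) xor_) (lookup-toggle P i k) ⟩
  (k ==F j) xor ((k ==F i) xor lookup P k) ≡⟨ xor-swap (k ==F j) (k ==F i) (lookup P k) ⟩
  (k ==F i) xor ((k ==F j) xor lookup P k) ≡⟨ cong ((k ==F i) xor_) (lookup-toggle P j k) ⟨
  (k ==F i) xor lookup (toggle P j) k   ≡⟨ lookup-toggle (toggle P j) i k ⟨
  lookup (toggle (toggle P j) i) k      ∎
  where
  open ≡-Reasoning
  xor-swap : ∀ x y z → x xor (y xor z) ≡ y xor (x xor z)
  xor-swap x y z = trans (sym (BP.xor-assoc x y z))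
    (trans (cong (_xor z) (BP.xor-comm x y)) (BP.xor-assoc y x z))

toggle-involutive : ∀ {m} (P : Subset m) i → toggle (toggle P i) i ≡ P
toggle-involutive P i = lookup-≗⇒≡ λ k → begin
  lookup (toggle (toggle P i) i) k         ≡⟨ lookup-toggle (toggle P i) i k ⟩
  (k ==F i) xor lookup (toggle P i) k      ≡⟨ cong ((k ==F i) xor_) (lookup-toggle P i k) ⟩
  (k ==F i) xor ((k ==F i) xor lookup P k) ≡⟨ BP.xor-assoc (k ==F i) (k ==F i) (lookup P k) ⟨
  ((k ==F i) xor (k ==F i)) xor lookup P k ≡⟨ cong (_xor lookup P k) (BP.xor-same (k ==F i)) ⟩
  lookup P k                               ∎
  where open ≡-Reasoning

toggle-≢ : ∀ {m} (P : Subset m) {W s} → lookup W s ≡ lookup P s → toggle P s ≢ W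
toggle-≢ P {W} {s} Ws≡Ps t≡W = BP.not-¬ refl
  (trans (sym Ws≡Ps) (trans (cong (λ X → lookup X s) (sym t≡W)) (lookup-toggle-self P s)))

toggle-zero : ∀ {m} b (S : Subset m) → toggle (b ∷ S) F.zero ≡ not b ∷ S
toggle-zero b S = lookup-≗⇒≡ λ where
  F.zero    → lookup-toggle-self (b ∷ S) F.zero
  (F.suc j) → lookup-toggle-other (b ∷ S) {F.zero} {F.suc j} λ ()

toggle-suc : ∀ {m} b (S : Subset m) x → toggle (b ∷ S) (F.suc x) ≡ b ∷ toggle S x
toggle-suc b S x = lookup-≗⇒≡ λ where
  F.zero    → lookup-toggle-other (b ∷ S) {F.suc x} {F.zero} λ ()
  (F.suc j) → trans (lookup-toggle (b ∷ S) (F.suc x) (F.suc j))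
                (trans (cong (_xor lookup S j) (suc-==F j x)) (sym (lookup-toggle S x j)))

∣toggle∣ : ∀ {m} (S : Subset m) x → lookup S x ≡ true → suc ∣ toggle S x ∣ ≡ ∣ S ∣
∣toggle∣ (true ∷ S)  F.zero    _ = cong (suc ∘ ∣_∣) (toggle-zero true S)
∣toggle∣ (true ∷ S)  (F.suc x) e = trans (cong (suc ∘ ∣_∣) (toggle-suc true S x)) (cong suc (∣toggle∣ S x e))
∣toggle∣ (false ∷ S) (F.suc x) e = trans (cong (suc ∘ ∣_∣) (toggle-suc false S x)) (∣toggle∣ S x e)

member≢nonmember : ∀ {m} (S : Subset m) {i j} → lookup S i ≡ true → lookup S j ≡ false → i ≢ j
member≢nonmember S Si Sj refl with () ← trans (sym Si) Sj

_⊕_ : ∀ {m} → Subset m → Subset m → Subset m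
_⊕_ = V.zipWith _xor_

lookup-⊕ : ∀ {m} (P Q : Subset m) j → lookup (P ⊕ Q) j ≡ lookup P j xor lookup Q j
lookup-⊕ P Q j = VP.lookup-zipWith _xor_ j P Q

toggle-⊕ : ∀ {m} (P Y : Subset m) x → toggle P x ⊕ Y ≡ toggle (P ⊕ Y) x
toggle-⊕ P Y x = lookup-≗⇒≡ λ j → begin
  lookup (toggle P x ⊕ Y) j                   ≡⟨ lookup-⊕ (toggle P x) Y j ⟩
  lookup (toggle P x) j xor lookup Y j        ≡⟨ cong (_xor lookup Y j) (lookup-toggle P x j) ⟩
  ((j ==F x) xor lookup P j) xor lookup Y j   ≡⟨ BP.xor-assoc (j ==F x) (lookup P j) (lookup Y j) ⟩
  (j ==F x) xor (lookup P j xor lookup Y j)   ≡⟨ cong ((j ==F x) xor_) (lookup-⊕ P Y j) ⟨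
  (j ==F x) xor lookup (P ⊕ Y) j              ≡⟨ lookup-toggle (P ⊕ Y) x j ⟨
  lookup (toggle (P ⊕ Y) x) j                 ∎
  where open ≡-Reasoning

∣⊕∣-toggle : ∀ {m} (P Y : Subset m) x → lookup P x ≢ lookup Y x → suc ∣ toggle P x ⊕ Y ∣ ≡ ∣ P ⊕ Y ∣
∣⊕∣-toggle P Y x Px≢Yx = trans (cong (suc ∘ ∣_∣) (toggle-⊕ P Y x))
  (∣toggle∣ (P ⊕ Y) x (trans (lookup-⊕ P Y x) (xor-≢ Px≢Yx)))

∣⊕-self∣ : ∀ {m} (P : Subset m) → ∣ P ⊕ P ∣ ≡ 0
∣⊕-self∣ []          = refl
∣⊕-self∣ (true ∷ P)  = ∣⊕-self∣ P
∣⊕-self∣ (false ∷ P) = ∣⊕-self∣ P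

∣⊕∣≡0⇒≡ : ∀ {m} (P Y : Subset m) → ∣ P ⊕ Y ∣ ≡ 0 → P ≡ Y
∣⊕∣≡0⇒≡ P Y ∣P⊕Y∣≡0 = lookup-≗⇒≡ λ j → decidable-stable (lookup P j BP.≟ lookup Y j)
  λ Pj≢Yj → ℕP.1+n≢0 (trans (∣⊕∣-toggle P Y j Pj≢Yj) ∣P⊕Y∣≡0)

∁-⊕ : ∀ {n} (v u : Subset n) → ∁ v ⊕ u ≡ ∁ (v ⊕ u)
∁-⊕ []      []      = refl
∁-⊕ (x ∷ v) (y ∷ u) = cong₂ _∷_ (sym (BP.not-distribˡ-xor x y)) (∁-⊕ v u)

⊕-⊥ : ∀ {n} (v : Subset n) → v ⊕ S.⊥ ≡ v
⊕-⊥ []      = refl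
⊕-⊥ (x ∷ v) = cong₂ _∷_ (BP.xor-identityʳ x) (⊕-⊥ v)

⊕-cancelˡ : ∀ {n} (v u : Subset n) → v ⊕ (v ⊕ u) ≡ u
⊕-cancelˡ []      []      = refl
⊕-cancelˡ (x ∷ v) (y ∷ u) = cong₂ _∷_
  (trans (sym (BP.xor-assoc x x y)) (cong (_xor y) (BP.xor-same x))) (⊕-cancelˡ v u)

∁-involutive : ∀ {n} (v : Subset n) → ∁ (∁ v) ≡ v
∁-involutive []      = refl
∁-involutive (x ∷ v) = cong₂ _∷_ (BP.not-involutive x) (∁-involutive v)

subset-of-size : ∀ n k → k ℕ.≤ n → Σ (Subset n) (λ D → ∣ D ∣ ≡ k)
subset-of-size zero    zero    _           = [] , refl
subset-of-size (suc n) zero    _           = S.⊥ , SP.∣⊥∣≡0 (suc n)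
subset-of-size (suc n) (suc k) (ℕ.s≤s k≤n) =
  let (D , ∣D∣≡k) = subset-of-size n k k≤n in (true ∷ D) , cong suc ∣D∣≡k

sumℤ-cong : ∀ {A : Set} {f g : A → ℤ} (xs : List A) → f ≗ g → sumℤ f xs ≡ sumℤ g xs
sumℤ-cong []       f≗g = refl
sumℤ-cong (x ∷ xs) f≗g = cong₂ _+_ (f≗g x) (sumℤ-cong xs f≗g)

sumℤ-++ : ∀ {A : Set} (f : A → ℤ) (xs ys : List A) → sumℤ f (xs L.++ ys) ≡ sumℤ f xs + sumℤ f ys
sumℤ-++ f []       ys = sym (ℤP.+-identityˡ _)
sumℤ-++ f (x ∷ xs) ys = trans (cong (f x +_) (sumℤ-++ f xs ys)) (sym (ℤP.+-assoc (f x) _ _))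

sumℤ-map : ∀ {A B : Set} (f : B → ℤ) (h : A → B) (xs : List A) → sumℤ f (L.map h xs) ≡ sumℤ (f ∘ h) xs
sumℤ-map f h []       = refl
sumℤ-map f h (x ∷ xs) = cong (f (h x) +_) (sumℤ-map f h xs)

sumℤ-concatMap : ∀ {A B : Set} (f : B → ℤ) (g : A → List B) (xs : List A) →
  sumℤ f (concatMap g xs) ≡ sumℤ (λ x → sumℤ f (g x)) xs
sumℤ-concatMap f g []       = refl
sumℤ-concatMap f g (x ∷ xs) =
  trans (sumℤ-++ f (g x) (concatMap g xs)) (cong (sumℤ f (g x) +_) (sumℤ-concatMap f g xs))

sumℤ-+ : ∀ {A : Set} (f g : A → ℤ) (xs : List A) → sumℤ (λ x → f x + g x) xs ≡ sumℤ f xs + sumℤ g xs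
sumℤ-+ f g []       = refl
sumℤ-+ f g (x ∷ xs) =
  trans (cong (f x + g x +_) (sumℤ-+ f g xs)) (interchange (f x) (g x) (sumℤ f xs) (sumℤ g xs))

sumℤ-zero : ∀ {A : Set} (xs : List A) → sumℤ (λ _ → 0ℤ) xs ≡ 0ℤ
sumℤ-zero []       = refl
sumℤ-zero (x ∷ xs) = trans (ℤP.+-identityˡ _) (sumℤ-zero xs)

sumℤ-const : ∀ {A : Set} (c : ℤ) (xs : List A) → sumℤ (λ _ → c) xs ≡ c * sumℤ (λ _ → ⁺ 1) xs
sumℤ-const c []       = sym (ℤP.*-zeroʳ c)
sumℤ-const c (x ∷ xs) = begin
  c + sumℤ (λ _ → c) xs ≡⟨ cong (c +_) (sumℤ-const c xs) ⟩
  c + c * s             ≡⟨ cong (_+ c * s) (ℤP.*-identityʳ c) ⟨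
  c * ⁺ 1 + c * s       ≡⟨ ℤP.*-distribˡ-+ c (⁺ 1) s ⟨
  c * (⁺ 1 + s)         ∎
  where
  open ≡-Reasoning
  s : ℤ
  s = sumℤ (λ _ → ⁺ 1) xs

sumℤ-filter : ∀ {A : Set} (f : A → ℤ) (p : A → Bool) (xs : List A) →
  sumℤ f (L.filter (λ x → p x BP.≟ true) xs) ≡ sumℤ (λ x → if p x then f x else 0ℤ) xs
sumℤ-filter f p []       = refl
sumℤ-filter f p (x ∷ xs) with p x
... | true  = cong (f x +_) (sumℤ-filter f p xs)
... | false = trans (sumℤ-filter f p xs) (sym (ℤP.+-identityˡ _))

sumℤ-allFin : ∀ k (g : Fin k → ℤ) → sumℤ g (allFin k) ≡ ∑[ x < k ] g x
sumℤ-allFin k g = go k (λ x → x)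
  where
  go : ∀ j (f : Fin j → Fin k) → sumℤ g (L.tabulate f) ≡ ∑[ x < j ] g (f x)
  go zero    f = refl
  go (suc j) f = cong (g (f F.zero) +_) (go j (f ∘ F.suc))

∑-δ : ∀ k (a : Fin k) (u : ℤ) → ∑[ x < k ] (if x ==F a then u else 0ℤ) ≡ u
∑-δ (suc k) F.zero u = begin
  u + ∑[ x < k ] (if F.suc x ==F F.zero then u else 0ℤ) ≡⟨ cong (u +_) (sum-replicate-zero k) ⟩
  u + 0ℤ                                                 ≡⟨ ℤP.+-identityʳ u ⟩
  u                                                      ∎
  where open ≡-Reasoning
∑-δ (suc k) (F.suc a) u = begin
  0ℤ + ∑[ x < k ] (if F.suc x ==F F.suc a then u else 0ℤ) ≡⟨ ℤP.+-identityˡ _ ⟩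
  ∑[ x < k ] (if F.suc x ==F F.suc a then u else 0ℤ)      ≡⟨ sum-cong-≗ (λ x → cong (if_then u else 0ℤ) (suc-==F x a)) ⟩
  ∑[ x < k ] (if x ==F a then u else 0ℤ)                  ≡⟨ ∑-δ k a u ⟩
  u                                                       ∎
  where open ≡-Reasoning

∑-over-subset : ∀ {k} (v : Subset k) (u : ℤ) → ∑[ x < k ] (if lookup v x then u else 0ℤ) ≡ ⁺ ∣ v ∣ * u
∑-over-subset []          u = refl
∑-over-subset (false ∷ v) u = trans (ℤP.+-identityˡ _) (∑-over-subset v u)
∑-over-subset (true ∷ v)  u = begin
  u + ∑[ x < _ ] (if lookup v x then u else 0ℤ) ≡⟨ cong (u +_) (∑-over-subset v u) ⟩
  u + ⁺ ∣ v ∣ * u                               ≡⟨ cong (_+ ⁺ ∣ v ∣ * u) (ℤP.*-identityˡ u) ⟨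
  ⁺ 1 * u + ⁺ ∣ v ∣ * u                         ≡⟨ ℤP.*-distribʳ-+ u (⁺ 1) (⁺ ∣ v ∣) ⟨
  ⁺ (suc ∣ v ∣) * u                             ∎
  where open ≡-Reasoning

-- Sequences of l distinct elements of S: toggling the drawn element s ∈ S removes it from S.
arrangements : ∀ {m} → Subset m → (l : ℕ) → List (Vec (Fin m) l)
arrangements S zero    = [] ∷ []
arrangements S (suc l) = concatMap
  (λ s → if lookup S s then L.map (s ∷_) (arrangements (toggle S s) l) else [])
  (allFin _)

#arrangements : ∀ {m} → Subset m → ℕ → ℤ
#arrangements S l = sumℤ (λ _ → ⁺ 1) (arrangements S l)

sumℤ-arrangements-suc : ∀ {m} l (S : Subset m) (f : Vec (Fin m) (suc l) → ℤ) →
  sumℤ f (arrangements S (suc l))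
    ≡ ∑[ x < m ] (if lookup S x then sumℤ (f ∘ (x ∷_)) (arrangements (toggle S x) l) else 0ℤ)
sumℤ-arrangements-suc {m} l S f =
  trans (sumℤ-concatMap f _ (allFin m)) (trans (sumℤ-allFin m _) (sum-cong-≗ first))
  where
  first : ∀ x → sumℤ f (if lookup S x then L.map (x ∷_) (arrangements (toggle S x) l) else [])
              ≡ (if lookup S x then sumℤ (f ∘ (x ∷_)) (arrangements (toggle S x) l) else 0ℤ)
  first x with lookup S x
  ... | true  = sumℤ-map f (x ∷_) (arrangements (toggle S x) l)
  ... | false = refl

#arrangements-∣∣ : ∀ {m} l (S : Subset m) → ∣ S ∣ ≡ l → #arrangements S l ≡ ⁺ (l !)
#arrangements-∣∣ zero    S _      = refl
#arrangements-∣∣ {m} (suc l) S ∣S∣≡1+l = begin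
  #arrangements S (suc l)
    ≡⟨ sumℤ-arrangements-suc l S (λ _ → ⁺ 1) ⟩
  ∑[ x < m ] (if lookup S x then #arrangements (toggle S x) l else 0ℤ)
    ≡⟨ sum-cong-≗ first ⟩
  ∑[ x < m ] (if lookup S x then ⁺ (l !) else 0ℤ)
    ≡⟨ ∑-over-subset S (⁺ (l !)) ⟩
  ⁺ ∣ S ∣ * ⁺ (l !)
    ≡⟨ cong (λ k → ⁺ k * ⁺ (l !)) ∣S∣≡1+l ⟩
  ⁺ (suc l) * ⁺ (l !)
    ≡⟨ ℤP.pos-* (suc l) (l !) ⟨
  ⁺ (suc l !)
    ∎
  where
  open ≡-Reasoning
  first : ∀ x → (if lookup S x then #arrangements (toggle S x) l else 0ℤ) ≡ (if lookup S x then ⁺ (l !) else 0ℤ)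
  first x with lookup S x in Sx
  ... | true  = #arrangements-∣∣ l (toggle S x) (ℕP.suc-injective (trans (∣toggle∣ S x Sx) ∣S∣≡1+l))
  ... | false = refl

-- The weights d! (l − d)!

weight : ℕ → ℕ → ℕ
weight l d = d ! ℕ.* (l ∸ d) !

weight-suc : ∀ l k → suc k ℕ.* weight (l ∸ 1) k ≡ weight l (suc k)
weight-suc l k = begin
  suc k ℕ.* (k ! ℕ.* (l ∸ 1 ∸ k) !)       ≡⟨ cong (λ t → suc k ℕ.* (k ! ℕ.* t !)) (ℕP.∸-+-assoc l 1 k) ⟩
  suc k ℕ.* (k ! ℕ.* (l ∸ suc k) !)       ≡⟨ ℕP.*-assoc (suc k) (k !) ((l ∸ suc k) !) ⟨
  weight l (suc k)                        ∎
  where open ≡-Reasoning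

weight-first-step : ∀ {m} l (P Y : Subset m) →
  [ P ==S Y ] * ⁺ (l !) + ⁺ ∣ P ⊕ Y ∣ * ⁺ (weight (l ∸ 1) (∣ P ⊕ Y ∣ ∸ 1)) ≡ ⁺ (weight l ∣ P ⊕ Y ∣)
weight-first-step l P Y = by-distance ∣ P ⊕ Y ∣ refl
  where
  open ≡-Reasoning
  by-distance : ∀ d → ∣ P ⊕ Y ∣ ≡ d →
    [ P ==S Y ] * ⁺ (l !) + ⁺ d * ⁺ (weight (l ∸ 1) (d ∸ 1)) ≡ ⁺ (weight l d)
  by-distance zero d≡0 = begin
    [ P ==S Y ] * ⁺ (l !) + 0ℤ * w ≡⟨ cong (λ b → [ b ] * ⁺ (l !) + 0ℤ * w) P==Y ⟩
    ⁺ 1 * ⁺ (l !) + 0ℤ * w         ≡⟨ cong₂ _+_ (ℤP.*-identityˡ (⁺ (l !))) (ℤP.*-zeroˡ w) ⟩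
    ⁺ (l !) + 0ℤ                   ≡⟨ ℤP.+-identityʳ (⁺ (l !)) ⟩
    ⁺ (l !)                        ≡⟨ cong ⁺ (ℕP.*-identityˡ (l !)) ⟨
    ⁺ (weight l 0)                 ∎
    where
    w : ℤ
    w = ⁺ (weight (l ∸ 1) 0)
    P==Y : (P ==S Y) ≡ true
    P==Y = trans (cong (P ==S_) (sym (∣⊕∣≡0⇒≡ P Y d≡0))) (==S-refl P)
  by-distance (suc k) d≡1+k = begin
    [ P ==S Y ] * ⁺ (l !) + ⁺ (suc k) * w ≡⟨ cong (λ b → [ b ] * ⁺ (l !) + ⁺ (suc k) * w) (==S-≢ P≢Y) ⟩
    0ℤ * ⁺ (l !) + ⁺ (suc k) * w         ≡⟨ cong (_+ ⁺ (suc k) * w) (ℤP.*-zeroˡ (⁺ (l !))) ⟩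
    0ℤ + ⁺ (suc k) * w                   ≡⟨ ℤP.+-identityˡ _ ⟩
    ⁺ (suc k) * w                        ≡⟨ ℤP.pos-* (suc k) (weight (l ∸ 1) k) ⟨
    ⁺ (suc k ℕ.* weight (l ∸ 1) k)       ≡⟨ cong ⁺ (weight-suc l k) ⟩
    ⁺ (weight l (suc k))                 ∎
    where
    w : ℤ
    w = ⁺ (weight (l ∸ 1) k)
    P≢Y : P ≢ Y
    P≢Y P≡Y = ℕP.1+n≢0 (trans (sym d≡1+k) (trans (cong (λ X → ∣ X ⊕ Y ∣) P≡Y) (∣⊕-self∣ Y)))

!*!-step : ∀ i j → i ℕ.< j → suc i ! ℕ.* j ! ℕ.< i ! ℕ.* suc j !
!*!-step i j i<j = subst₂ ℕ._<_ (sym left) (sym right)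
  (ℕP.*-monoˡ-< (i ! ℕ.* j !) {{ℕP._!*_!≢0 i j}} (ℕ.s≤s i<j))
  where
  open ≡-Reasoning
  left : suc i ! ℕ.* j ! ≡ suc i ℕ.* (i ! ℕ.* j !)
  left = ℕP.*-assoc (suc i) (i !) (j !)
  right : i ! ℕ.* suc j ! ≡ suc j ℕ.* (i ! ℕ.* j !)
  right = begin
    i ! ℕ.* (suc j ℕ.* j !)   ≡⟨ ℕP.*-assoc (i !) (suc j) (j !) ⟨
    (i ! ℕ.* suc j) ℕ.* j !   ≡⟨ cong (ℕ._* j !) (ℕP.*-comm (i !) (suc j)) ⟩
    (suc j ℕ.* i !) ℕ.* j !   ≡⟨ ℕP.*-assoc (suc j) (i !) (j !) ⟩
    suc j ℕ.* (i ! ℕ.* j !)   ∎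

weight-step : ∀ n k → suc (suc k) ℕ.≤ n ∸ k → weight n (suc k) ℕ.< weight n k
weight-step n k 2+k≤n-k with n ∸ k in n-k≡
... | suc r = subst (ℕ._< k ! ℕ.* suc r !) (cong (λ t → suc k ! ℕ.* t !) (sym n-1-k≡r))
  (!*!-step k r (ℕP.≤-pred 2+k≤n-k))
  where
  n-1-k≡r : n ∸ suc k ≡ r
  n-1-k≡r = trans (sym (ℕP.pred[m∸n]≡m∸[1+n] n k)) (cong ℕ.pred n-k≡)

room-for-step : ∀ n k → suc k ℕ.+ suc k ℕ.≤ n → suc (suc k) ℕ.≤ n ∸ k
room-for-step n k 2k+2≤n = subst (ℕ._≤ n ∸ k) (ℕP.m+n∸m≡n k (suc (suc k)))
  (ℕP.∸-monoˡ-≤ k (subst (ℕ._≤ n) (sym (ℕP.+-suc k (suc k))) 2k+2≤n))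

weight-decreasing : ∀ n {k j} → k ℕ.< j → j ℕ.+ j ℕ.≤ n → weight n j ℕ.< weight n k
weight-decreasing n {k} {suc j} (ℕ.s≤s k≤j) 2j≤n with k ℕ.≟ j
... | yes refl = weight-step n k (room-for-step n k 2j≤n)
... | no k≢j   = ℕP.<-trans (weight-step n j (room-for-step n j 2j≤n))
  (weight-decreasing n (ℕP.≤∧≢⇒< k≤j k≢j) (ℕP.≤-trans (ℕP.+-mono-≤ (ℕP.n≤1+n j) (ℕP.n≤1+n j)) 2j≤n))

weight-sym : ∀ n k → k ℕ.≤ n → weight n (n ∸ k) ≡ weight n k
weight-sym n k k≤n = trans (cong (λ t → (n ∸ k) ! ℕ.* t !) (ℕP.m∸[m∸n]≡n k≤n)) (ℕP.*-comm ((n ∸ k) !) (k !))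

⌈n/2⌉≤1+⌊n/2⌋ : ∀ n → ⌈ n /2⌉ ℕ.≤ suc ⌊ n /2⌋
⌈n/2⌉≤1+⌊n/2⌋ zero          = ℕ.z≤n
⌈n/2⌉≤1+⌊n/2⌋ (suc zero)    = ℕ.s≤s ℕ.z≤n
⌈n/2⌉≤1+⌊n/2⌋ (suc (suc n)) = ℕ.s≤s (⌈n/2⌉≤1+⌊n/2⌋ n)

n∸⌈n/2⌉≡⌊n/2⌋ : ∀ n → n ∸ ⌈ n /2⌉ ≡ ⌊ n /2⌋
n∸⌈n/2⌉≡⌊n/2⌋ n =
  trans (cong (_∸ ⌈ n /2⌉) (sym (ℕP.⌊n/2⌋+⌈n/2⌉≡n n))) (ℕP.m+n∸n≡m ⌊ n /2⌋ ⌈ n /2⌉)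

n∸⌊n/2⌋≡⌈n/2⌉ : ∀ n → n ∸ ⌊ n /2⌋ ≡ ⌈ n /2⌉
n∸⌊n/2⌋≡⌈n/2⌉ n =
  trans (cong (_∸ ⌊ n /2⌋) (sym (ℕP.⌊n/2⌋+⌈n/2⌉≡n n))) (ℕP.m+n∸m≡n ⌊ n /2⌋ ⌈ n /2⌉)

⌊n/2⌋+⌊n/2⌋≤n : ∀ n → ⌊ n /2⌋ ℕ.+ ⌊ n /2⌋ ℕ.≤ n
⌊n/2⌋+⌊n/2⌋≤n n =
  subst (⌊ n /2⌋ ℕ.+ ⌊ n /2⌋ ℕ.≤_) (ℕP.⌊n/2⌋+⌈n/2⌉≡n n) (ℕP.+-monoʳ-≤ ⌊ n /2⌋ (ℕP.⌊n/2⌋≤⌈n/2⌉ n))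

weight-minimum : ∀ n k → k ℕ.≤ n → k ≢ ⌊ n /2⌋ → k ≢ ⌈ n /2⌉ → weight n ⌊ n /2⌋ ℕ.< weight n k
weight-minimum n k k≤n k≢f k≢c with ℕP.<-cmp k ⌊ n /2⌋
... | tri< k<f _ _ = weight-decreasing n k<f (⌊n/2⌋+⌊n/2⌋≤n n)
... | tri≈ _ k≡f _ = contradiction k≡f k≢f
... | tri> _ _ f<k = subst (weight n ⌊ n /2⌋ ℕ.<_) (weight-sym n k k≤n)
  (weight-decreasing n n-k<f (⌊n/2⌋+⌊n/2⌋≤n n))
  where
  c<k : ⌈ n /2⌉ ℕ.< k
  c<k = ℕP.≤∧≢⇒< (ℕP.≤-trans (⌈n/2⌉≤1+⌊n/2⌋ n) f<k) (k≢c ∘ sym)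
  n-k<f : n ∸ k ℕ.< ⌊ n /2⌋
  n-k<f = subst (n ∸ k ℕ.<_) (n∸⌈n/2⌉≡⌊n/2⌋ n) (ℕP.∸-monoʳ-< c<k k≤n)

-- Flow across the edge from Y to Y ∪ {a}

module Flow {m} (Y : Subset m) (a : Fin m) where

  Z : Subset m
  Z = Y ∪ ⁅ a ⁆

  lookup-Z-a : lookup Z a ≡ true
  lookup-Z-a = trans (VP.lookup-zipWith _∨_ a Y ⁅ a ⁆)
    (trans (cong (lookup Y a ∨_) (trans (lookup-⁅⁆ a a) (==F-refl a))) (BP.∨-zeroʳ _))

  lookup-Z-≢ : ∀ {j} → j ≢ a → lookup Z j ≡ lookup Y j
  lookup-Z-≢ {j} j≢a = trans (VP.lookup-zipWith _∨_ j Y ⁅ a ⁆)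
    (trans (cong (lookup Y j ∨_) (trans (lookup-⁅⁆ a j) (==F-≢ j≢a))) (BP.∨-identityʳ _))

  toggle-Y-a : lookup Y a ≡ false → toggle Y a ≡ Z
  toggle-Y-a Ya = lookup-≗⇒≡ pointwise
    where
    pointwise : ∀ j → lookup (toggle Y a) j ≡ lookup Z j
    pointwise j with j F.≟ a
    ... | yes refl = trans (lookup-toggle-self Y j) (trans (cong not Ya) (sym lookup-Z-a))
    ... | no j≢a   = trans (lookup-toggle-other Y j≢a) (sym (lookup-Z-≢ j≢a))

  crossing : Subset m → Subset m → ℤ
  crossing P P' = [ (P ==S Y) ∧ (P' ==S Z) ] - [ (P' ==S Y) ∧ (P ==S Z) ]

  crossing-antisym : ∀ P P' → crossing P' P ≡ - crossing P P'
  crossing-antisym P P' = sym (⁻¹-anti-homo‿- [ (P ==S Y) ∧ (P' ==S Z) ] [ (P' ==S Y) ∧ (P ==S Z) ])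

  crossing-≡0 : ∀ P P' → (P ≡ Y → P' ≢ Z) → (P' ≡ Y → P ≢ Z) → crossing P P' ≡ 0ℤ
  crossing-≡0 P P' h h' = cong₂ _-_ ([==S∧==S]≡0 h) ([==S∧==S]≡0 h')

  crossing-toggle-≢a : ∀ P {s} → s ≢ a → crossing P (toggle P s) ≡ 0ℤ
  crossing-toggle-≢a P {s} s≢a = crossing-≡0 P (toggle P s)
    (λ P≡Y → toggle-≢ P (trans (lookup-Z-≢ s≢a) (cong (λ X → lookup X s) (sym P≡Y))))
    (λ tP≡Y P≡Z → toggle-≢ P (trans (sym (lookup-Z-≢ s≢a)) (cong (λ X → lookup X s) (sym P≡Z))) tP≡Y)

  crossing-disagree : ∀ P P' {x} → x ≢ a → lookup P x ≢ lookup Y x → crossing P P' ≡ 0ℤ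
  crossing-disagree P P' {x} x≢a Px≢Yx = crossing-≡0 P P'
    (λ P≡Y _ → Px≢Yx (cong (λ X → lookup X x) P≡Y))
    (λ _ P≡Z → Px≢Yx (trans (cong (λ X → lookup X x) P≡Z) (lookup-Z-≢ x≢a)))

  crossing-toggle-a : ∀ P → lookup P a ≡ false → lookup Y a ≡ false → crossing P (toggle P a) ≡ [ P ==S Y ]
  crossing-toggle-a P Pa Ya = begin
    [ (P ==S Y) ∧ (toggle P a ==S Z) ] - [ (toggle P a ==S Y) ∧ (P ==S Z) ]
      ≡⟨ cong (λ t → [ (P ==S Y) ∧ (toggle P a ==S Z) ] - t) ([==S∧==S]≡0 λ _ P≡Z → P≢Z P≡Z) ⟩
    [ (P ==S Y) ∧ (toggle P a ==S Z) ] - 0ℤ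
      ≡⟨ ℤP.+-identityʳ _ ⟩
    [ (P ==S Y) ∧ (toggle P a ==S Z) ]
      ≡⟨ cong [_] only-Y ⟩
    [ P ==S Y ]
      ∎
    where
    open ≡-Reasoning
    P≢Z : P ≢ Z
    P≢Z P≡Z with () ← trans (sym Pa) (trans (cong (λ X → lookup X a) P≡Z) lookup-Z-a)
    only-Y : (P ==S Y) ∧ (toggle P a ==S Z) ≡ (P ==S Y)
    only-Y with VP.≡-dec BP._≟_ P Y
    ... | yes refl = trans (cong (_==S Z) (toggle-Y-a Ya)) (==S-refl Z)
    ... | no _     = refl

  walk-toggle-a : ∀ {l} (σ : Vec (Fin m) l) P → walk Y Z (toggle P a) σ ≡ - walk Y Z P σ
  walk-toggle-a []      P = refl
  walk-toggle-a (s ∷ σ) P = begin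
    crossing (toggle P a) (toggle (toggle P a) s) + walk Y Z (toggle (toggle P a) s) σ
      ≡⟨ cong (λ X → crossing (toggle P a) X + walk Y Z X σ) (toggle-comm P a s) ⟩
    crossing (toggle P a) (toggle (toggle P s) a) + walk Y Z (toggle (toggle P s) a) σ
      ≡⟨ cong₂ _+_ first-step (walk-toggle-a σ (toggle P s)) ⟩
    - crossing P (toggle P s) + - walk Y Z (toggle P s) σ
      ≡⟨ ℤP.neg-distrib-+ (crossing P (toggle P s)) (walk Y Z (toggle P s) σ) ⟨
    - (crossing P (toggle P s) + walk Y Z (toggle P s) σ)
      ∎
    where
    open ≡-Reasoning
    first-step : crossing (toggle P a) (toggle (toggle P s) a) ≡ - crossing P (toggle P s)
    first-step with s F.≟ a
    ... | yes refl = trans (cong (crossing (toggle P s)) (toggle-involutive P s)) (crossing-antisym P (toggle P s))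
    ... | no s≢a   = begin
      crossing (toggle P a) (toggle (toggle P s) a) ≡⟨ cong (crossing (toggle P a)) (toggle-comm P a s) ⟨
      crossing (toggle P a) (toggle (toggle P a) s) ≡⟨ crossing-toggle-≢a (toggle P a) s≢a ⟩
      0ℤ                                           ≡⟨ cong -_ (crossing-toggle-≢a P s≢a) ⟨
      - crossing P (toggle P s)                    ∎

  flow : Subset m → ℕ → Subset m → ℤ
  flow S l P = sumℤ (walk Y Z P) (arrangements S l)

  flow-summand : Subset m → ℕ → Subset m → Fin m → ℤ
  flow-summand S l P x = if lookup S x
    then crossing P (toggle P x) * #arrangements (toggle S x) l + flow (toggle S x) l (toggle P x)
    else 0ℤ

  flow-suc : ∀ l S P → flow S (suc l) P ≡ ∑[ x < m ] flow-summand S l P x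
  flow-suc l S P = trans (sumℤ-arrangements-suc l S (walk Y Z P)) (sum-cong-≗ summand)
    where
    summand : ∀ x → (if lookup S x then sumℤ (walk Y Z P ∘ (x ∷_)) (arrangements (toggle S x) l) else 0ℤ)
                  ≡ flow-summand S l P x
    summand x with lookup S x
    ... | false = refl
    ... | true  = let c = crossing P (toggle P x); A = arrangements (toggle S x) l in
      trans (sumℤ-+ (λ _ → c) (walk Y Z (toggle P x)) A) (cong (_+ flow (toggle S x) l (toggle P x)) (sumℤ-const c A))

  flow-vanishes : (I : Subset m → Subset m → Set) →
    (∀ S P s → I S P → lookup S s ≡ true → crossing P (toggle P s) ≡ 0ℤ × I (toggle S s) (toggle P s)) →
    ∀ l S P → I S P → flow S l P ≡ 0ℤ
  flow-vanishes I step zero    S P _   = refl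
  flow-vanishes I step (suc l) S P inv =
    trans (flow-suc l S P) (trans (sum-cong-≗ summand≡0) (sum-replicate-zero m))
    where
    summand≡0 : ∀ x → flow-summand S l P x ≡ 0ℤ
    summand≡0 x with lookup S x in Sx
    ... | false = refl
    ... | true  = cong₂ _+_
      (trans (cong (λ c → c * #arrangements (toggle S x) l) (proj₁ (step S P x inv Sx)))
             (ℤP.*-zeroˡ (#arrangements (toggle S x) l)))
      (flow-vanishes I step l (toggle S x) (toggle P x) (proj₂ (step S P x inv Sx)))

  flow-a∉ : ∀ l S P → lookup S a ≡ false → flow S l P ≡ 0ℤ
  flow-a∉ = flow-vanishes (λ S _ → lookup S a ≡ false) λ S P s Sa Ss →
    let s≢a = member≢nonmember S Ss Sa in
    crossing-toggle-≢a P s≢a , trans (lookup-toggle-other S (s≢a ∘ sym)) Sa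

  flow-disagree : ∀ {x} → x ≢ a → ∀ l S P → lookup S x ≡ false → lookup P x ≢ lookup Y x → flow S l P ≡ 0ℤ
  flow-disagree {x} x≢a l S P Sx Px≢Yx =
    flow-vanishes (λ S P → lookup S x ≡ false × lookup P x ≢ lookup Y x) step l S P (Sx , Px≢Yx)
    where
    step : ∀ S P s → lookup S x ≡ false × lookup P x ≢ lookup Y x → lookup S s ≡ true →
      crossing P (toggle P s) ≡ 0ℤ × (lookup (toggle S s) x ≡ false × lookup (toggle P s) x ≢ lookup Y x)
    step S P s (Sx , Px≢Yx) Ss =
      let x≢s = member≢nonmember S Ss Sx ∘ sym in
      crossing-disagree P (toggle P s) x≢a Px≢Yx ,
      trans (lookup-toggle-other S x≢s) Sx ,
      λ e → Px≢Yx (trans (sym (lookup-toggle-other P x≢s)) e)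

  AgreesOutside : Subset m → Subset m → Set
  AgreesOutside S P = ∀ x → lookup S x ≡ false → lookup P x ≡ lookup Y x

  module _ (Ya : lookup Y a ≡ false) where

    flow-summand-a : ∀ l S P → ∣ S ∣ ≡ suc l → lookup S a ≡ true → lookup P a ≡ false →
      flow-summand S l P a ≡ [ P ==S Y ] * ⁺ (l !)
    flow-summand-a l S P ∣S∣≡1+l Sa Pa = begin
      flow-summand S l P a
        ≡⟨ cong (λ b → if b then crossing P (toggle P a) * #arrangements (toggle S a) l
                                  + flow (toggle S a) l (toggle P a) else 0ℤ) Sa ⟩
      crossing P (toggle P a) * #arrangements (toggle S a) l + flow (toggle S a) l (toggle P a)
        ≡⟨ cong₂ _+_ (cong₂ _*_ (crossing-toggle-a P Pa Ya) (#arrangements-∣∣ l (toggle S a) ∣S-a∣≡l))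
                     (flow-a∉ l (toggle S a) (toggle P a) (trans (lookup-toggle-self S a) (cong not Sa))) ⟩
      [ P ==S Y ] * ⁺ (l !) + 0ℤ
        ≡⟨ ℤP.+-identityʳ _ ⟩
      [ P ==S Y ] * ⁺ (l !)
        ∎
      where
      open ≡-Reasoning
      ∣S-a∣≡l : ∣ toggle S a ∣ ≡ l
      ∣S-a∣≡l = ℕP.suc-injective (trans (∣toggle∣ S a Sa) ∣S∣≡1+l)

    -- A walk from P crosses the edge only when it toggles a, and it crosses forwards exactly when the
    -- elements drawn before a form P ⊕ Y; this happens for d! (l − 1 − d)! arrangements, d = |P ⊕ Y|.
    FlowValue : ℕ → Set
    FlowValue l = ∀ S P → ∣ S ∣ ≡ l → lookup S a ≡ true → lookup P a ≡ false → AgreesOutside S P →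
      flow S l P ≡ ⁺ (weight (l ∸ 1) ∣ P ⊕ Y ∣)

    flow-summand-≢a : ∀ {l} → FlowValue l → ∀ S P → ∣ S ∣ ≡ suc l → lookup S a ≡ true → lookup P a ≡ false →
      AgreesOutside S P → ∀ {x} → x ≢ a →
      flow-summand S l P x ≡ (if lookup (P ⊕ Y) x then ⁺ (weight (l ∸ 1) (∣ P ⊕ Y ∣ ∸ 1)) else 0ℤ)
    flow-summand-≢a {l} flow-value-l S P ∣S∣≡1+l Sa Pa agree {x} x≢a with lookup S x in Sx
    ... | false = sym (cong (if_then W else 0ℤ) (trans (lookup-⊕ P Y x) (xor-≡ (agree x Sx))))
      where
      W : ℤ
      W = ⁺ (weight (l ∸ 1) (∣ P ⊕ Y ∣ ∸ 1))
    ... | true  = begin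
      crossing P (toggle P x) * #arrangements (toggle S x) l + flow (toggle S x) l (toggle P x)
        ≡⟨ cong (_+ flow (toggle S x) l (toggle P x))
             (trans (cong (λ c → c * #arrangements (toggle S x) l) (crossing-toggle-≢a P x≢a))
                    (ℤP.*-zeroˡ (#arrangements (toggle S x) l))) ⟩
      0ℤ + flow (toggle S x) l (toggle P x)
        ≡⟨ ℤP.+-identityˡ _ ⟩
      flow (toggle S x) l (toggle P x)
        ≡⟨ by-disagreement (lookup P x BP.≟ lookup Y x) ⟩
      (if lookup (P ⊕ Y) x then W else 0ℤ)
        ∎
      where
      open ≡-Reasoning
      W : ℤ
      W = ⁺ (weight (l ∸ 1) (∣ P ⊕ Y ∣ ∸ 1))
      agree' : lookup P x ≢ lookup Y x → AgreesOutside (toggle S x) (toggle P x)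
      agree' Px≢Yx y Sy with y F.≟ x
      ... | yes refl = trans (lookup-toggle-self P y) (≢⇒not≡ Px≢Yx)
      ... | no y≢x   = trans (lookup-toggle-other P y≢x) (agree y (trans (sym (lookup-toggle-other S y≢x)) Sy))
      by-disagreement : Dec (lookup P x ≡ lookup Y x) →
        flow (toggle S x) l (toggle P x) ≡ (if lookup (P ⊕ Y) x then W else 0ℤ)
      by-disagreement (yes Px≡Yx) = trans
        (flow-disagree x≢a l (toggle S x) (toggle P x) (trans (lookup-toggle-self S x) (cong not Sx))
          λ e → BP.not-¬ (sym Px≡Yx) (sym (trans (sym (lookup-toggle-self P x)) e)))
        (sym (cong (if_then W else 0ℤ) (trans (lookup-⊕ P Y x) (xor-≡ Px≡Yx))))
      by-disagreement (no Px≢Yx) = trans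
        (flow-value-l (toggle S x) (toggle P x) (ℕP.suc-injective (trans (∣toggle∣ S x Sx) ∣S∣≡1+l))
          (trans (lookup-toggle-other S (x≢a ∘ sym)) Sa) (trans (lookup-toggle-other P (x≢a ∘ sym)) Pa)
          (agree' Px≢Yx))
        (trans (cong (λ k → ⁺ (weight (l ∸ 1) (k ∸ 1))) (∣⊕∣-toggle P Y x Px≢Yx))
          (sym (cong (if_then W else 0ℤ) (trans (lookup-⊕ P Y x) (xor-≢ Px≢Yx)))))

    flow-value : ∀ l → FlowValue l
    flow-value zero    S P ∣S∣≡0 Sa _ _ = contradiction (trans (∣toggle∣ S a Sa) ∣S∣≡0) ℕP.1+n≢0
    flow-value (suc l) S P ∣S∣≡1+l Sa Pa agree = begin
      flow S (suc l) P
        ≡⟨ flow-suc l S P ⟩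
      ∑[ x < m ] flow-summand S l P x
        ≡⟨ sum-cong-≗ summand ⟩
      ∑[ x < m ] ((if x ==F a then U else 0ℤ) + (if lookup (P ⊕ Y) x then W else 0ℤ))
        ≡⟨ ∑-distrib-+ (λ x → if x ==F a then U else 0ℤ) (λ x → if lookup (P ⊕ Y) x then W else 0ℤ) ⟩
      ∑[ x < m ] (if x ==F a then U else 0ℤ) + ∑[ x < m ] (if lookup (P ⊕ Y) x then W else 0ℤ)
        ≡⟨ cong₂ _+_ (∑-δ m a U) (∑-over-subset (P ⊕ Y) W) ⟩
      U + ⁺ ∣ P ⊕ Y ∣ * W
        ≡⟨ weight-first-step l P Y ⟩
      ⁺ (weight l ∣ P ⊕ Y ∣)
        ∎
      where
      open ≡-Reasoning
      U W : ℤ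
      U = [ P ==S Y ] * ⁺ (l !)
      W = ⁺ (weight (l ∸ 1) (∣ P ⊕ Y ∣ ∸ 1))
      summand : ∀ x → flow-summand S l P x ≡ (if x ==F a then U else 0ℤ) + (if lookup (P ⊕ Y) x then W else 0ℤ)
      summand x with x F.≟ a
      ... | yes refl = trans (flow-summand-a l S P ∣S∣≡1+l Sa Pa) (sym (trans
        (cong (U +_) (cong (if_then W else 0ℤ) (trans (lookup-⊕ P Y x) (xor-≡ (trans Pa (sym Ya))))))
        (ℤP.+-identityʳ U)))
      ... | no x≢a = trans (flow-summand-≢a (flow-value l) S P ∣S∣≡1+l Sa Pa agree x≢a) (sym (ℤP.+-identityˡ _))

-- Permutations as arrangements

isArrangement : ∀ {m l} → Subset m → Vec (Fin m) l → Bool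
isArrangement S []      = true
isArrangement S (s ∷ σ) = lookup S s ∧ isArrangement (toggle S s) σ

Distinct : ∀ {m l} → Vec (Fin m) l → Set
Distinct σ = Injective _≡_ _≡_ (lookup σ)

EntriesIn : ∀ {m l} → Subset m → Vec (Fin m) l → Set
EntriesIn S σ = ∀ i → lookup S (lookup σ i) ≡ true

isArrangement⇒ : ∀ {m l} (S : Subset m) (σ : Vec (Fin m) l) →
  isArrangement S σ ≡ true → EntriesIn S σ × Distinct σ
isArrangement⇒ S []      _ = (λ ()) , λ { {()} }
isArrangement⇒ S (s ∷ σ) e with ∧-≡-true {lookup S s} e
... | Ss , rest with isArrangement⇒ (toggle S s) σ rest
... | within , distinct = within' , distinct'
  where
  σ≢s : ∀ i → lookup σ i ≢ s
  σ≢s i = member≢nonmember (toggle S s) (within i) (trans (lookup-toggle-self S s) (cong not Ss))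
  within' : EntriesIn S (s ∷ σ)
  within' F.zero    = Ss
  within' (F.suc i) = trans (sym (lookup-toggle-other S (σ≢s i))) (within i)
  distinct' : Distinct (s ∷ σ)
  distinct' {F.zero}  {F.zero}  _ = refl
  distinct' {F.zero}  {F.suc j} e = contradiction (sym e) (σ≢s j)
  distinct' {F.suc i} {F.zero}  e = contradiction e (σ≢s i)
  distinct' {F.suc i} {F.suc j} e = cong F.suc (distinct e)

isArrangement⇐ : ∀ {m l} (S : Subset m) (σ : Vec (Fin m) l) →
  EntriesIn S σ → Distinct σ → isArrangement S σ ≡ true
isArrangement⇐ S []      _      _        = refl
isArrangement⇐ S (s ∷ σ) within distinct =
  cong₂ _∧_ (within F.zero) (isArrangement⇐ (toggle S s) σ within' (FP.suc-injective ∘ distinct))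
  where
  σ≢s : ∀ i → lookup σ i ≢ s
  σ≢s i e with () ← distinct {F.suc i} {F.zero} e
  within' : EntriesIn (toggle S s) σ
  within' i = trans (lookup-toggle-other S (σ≢s i)) (within (F.suc i))

sumℤ-allVecs-isArrangement : ∀ {m} l (S : Subset m) (f : Vec (Fin m) l → ℤ) →
  sumℤ (λ σ → if isArrangement S σ then f σ else 0ℤ) (allVecs (allFin m) l) ≡ sumℤ f (arrangements S l)
sumℤ-allVecs-isArrangement zero    S f = refl
sumℤ-allVecs-isArrangement {m} (suc l) S f = begin
  sumℤ g (concatMap (λ x → L.map (x ∷_) (allVecs (allFin m) l)) (allFin m))
    ≡⟨ sumℤ-concatMap g _ (allFin m) ⟩
  sumℤ (λ x → sumℤ g (L.map (x ∷_) (allVecs (allFin m) l))) (allFin m)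
    ≡⟨ sumℤ-cong (allFin m) (λ x → trans (sumℤ-map g (x ∷_) (allVecs (allFin m) l)) (first x)) ⟩
  sumℤ (λ x → sumℤ f (if lookup S x then L.map (x ∷_) (arrangements (toggle S x) l) else [])) (allFin m)
    ≡⟨ sumℤ-concatMap f _ (allFin m) ⟨
  sumℤ f (arrangements S (suc l))
    ∎
  where
  open ≡-Reasoning
  g : Vec (Fin m) (suc l) → ℤ
  g σ = if isArrangement S σ then f σ else 0ℤ
  first : ∀ x →
    sumℤ (λ v → if lookup S x ∧ isArrangement (toggle S x) v then f (x ∷ v) else 0ℤ) (allVecs (allFin m) l)
      ≡ sumℤ f (if lookup S x then L.map (x ∷_) (arrangements (toggle S x) l) else [])
  first x with lookup S x
  ... | true  = trans (sumℤ-allVecs-isArrangement l (toggle S x) (f ∘ (x ∷_)))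
                      (sym (sumℤ-map f (x ∷_) (arrangements (toggle S x) l)))
  ... | false = sumℤ-zero (allVecs (allFin m) l)

allB-tabulate⇒ : ∀ {A : Set} (p : A → Bool) {k} (f : Fin k → A) →
  allB p (L.tabulate f) ≡ true → ∀ i → p (f i) ≡ true
allB-tabulate⇒ p f e F.zero    = proj₁ (∧-≡-true {p (f F.zero)} e)
allB-tabulate⇒ p f e (F.suc i) = allB-tabulate⇒ p (f ∘ F.suc) (proj₂ (∧-≡-true {p (f F.zero)} e)) i

allB-tabulate⇐ : ∀ {A : Set} (p : A → Bool) {k} (f : Fin k → A) →
  (∀ i → p (f i) ≡ true) → allB p (L.tabulate f) ≡ true
allB-tabulate⇐ p {zero}  f h = refl
allB-tabulate⇐ p {suc k} f h = cong₂ _∧_ (h F.zero) (allB-tabulate⇐ p (f ∘ F.suc) (h ∘ F.suc))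

implication⇒ : ∀ {m k} {u v : Fin m} {i j : Fin k} → (if u ==F v then i ==F j else true) ≡ true → u ≡ v → i ≡ j
implication⇒ {u = u} {v} e u≡v with u F.≟ v
... | yes _   = ==F⇒≡ e
... | no u≢v  = contradiction u≡v u≢v

implication⇐ : ∀ {m k} {u v : Fin m} {i j : Fin k} → (u ≡ v → i ≡ j) → (if u ==F v then i ==F j else true) ≡ true
implication⇐ {u = u} {v} {i} h with u F.≟ v
... | yes u≡v = trans (cong (i ==F_) (sym (h u≡v))) (==F-refl i)
... | no _    = refl

isPerm⇔Distinct : ∀ {m} (σ : Vec (Fin m) m) → isPerm σ ≡ true ⇔ Distinct σ
isPerm⇔Distinct {m} σ = mk⇔
  (λ e {i} {j} → implication⇒
     (allB-tabulate⇒ (inner i) (λ j → j) (allB-tabulate⇒ (λ i → allB (inner i) (allFin m)) (λ i → i) e i) j))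
  (λ distinct → allB-tabulate⇐ (λ i → allB (inner i) (allFin m)) (λ i → i) λ i →
                   allB-tabulate⇐ (inner i) (λ j → j) λ j → implication⇐ distinct)
  where
  inner : Fin m → Fin m → Bool
  inner i j = if lookup σ i ==F lookup σ j then i ==F j else true

isArrangement-⊤⇔Distinct : ∀ {m l} (σ : Vec (Fin m) l) → isArrangement ⊤ σ ≡ true ⇔ Distinct σ
isArrangement-⊤⇔Distinct σ = mk⇔
  (proj₂ ∘ isArrangement⇒ ⊤ σ)
  (isArrangement⇐ ⊤ σ (λ i → VP.lookup-replicate (lookup σ i) true))

sumℤ-Perms : ∀ m (f : Vec (Fin m) m → ℤ) → sumℤ f (Perms m) ≡ sumℤ f (arrangements ⊤ m)
sumℤ-Perms m f = begin
  sumℤ f (Perms m)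
    ≡⟨ sumℤ-filter f isPerm (allVecs (allFin m) m) ⟩
  sumℤ (λ σ → if isPerm σ then f σ else 0ℤ) (allVecs (allFin m) m)
    ≡⟨ sumℤ-cong (allVecs (allFin m) m) (λ σ → cong (if_then f σ else 0ℤ) (isPerm≡isArrangement-⊤ σ)) ⟩
  sumℤ (λ σ → if isArrangement ⊤ σ then f σ else 0ℤ) (allVecs (allFin m) m)
    ≡⟨ sumℤ-allVecs-isArrangement m ⊤ f ⟩
  sumℤ f (arrangements ⊤ m)
    ∎
  where
  open ≡-Reasoning
  isPerm≡isArrangement-⊤ : ∀ σ → isPerm σ ≡ isArrangement ⊤ σ
  isPerm≡isArrangement-⊤ σ = BP.⇔→≡ (⇔.trans (isPerm⇔Distinct σ) (⇔.sym (isArrangement-⊤⇔Distinct σ)))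

sumℤ-walk-Perms : ∀ {m} (Y : Subset m) (a : Fin m) → lookup Y a ≡ false → ∀ P → lookup P a ≡ false →
  sumℤ (walk Y (Y ∪ ⁅ a ⁆) P) (Perms m) ≡ ⁺ (weight (m ∸ 1) ∣ P ⊕ Y ∣)
sumℤ-walk-Perms {m} Y a Ya P Pa = trans (sumℤ-Perms m (walk Y (Y ∪ ⁅ a ⁆) P))
  (Flow.flow-value Y a Ya m ⊤ P (SP.∣⊤∣≡n m) (VP.lookup-replicate a true) Pa
    λ x ⊤x≡false → contradiction (trans (sym (VP.lookup-replicate x true)) ⊤x≡false) λ ())

lookup-last : ∀ {n} (v : Subset n) b → lookup (v ∷ʳ b) (fromℕ n) ≡ b
lookup-last []      b = refl
lookup-last (x ∷ v) b = lookup-last v b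

toggle-last : ∀ {n} (v : Subset n) → toggle (lift v) (fromℕ n) ≡ v ∷ʳ true
toggle-last []      = toggle-zero false []
toggle-last (x ∷ v) = trans (toggle-suc x (lift v) (fromℕ _)) (cong (x ∷_) (toggle-last v))

restrict-∷ʳ : ∀ {n} (v : Subset n) b → restrict (v ∷ʳ b) ≡ v
restrict-∷ʳ []      b = refl
restrict-∷ʳ (x ∷ v) b = cong (x ∷_) (restrict-∷ʳ v b)

⊕-∷ʳ : ∀ {n} (v u : Subset n) b c → (v ∷ʳ b) ⊕ (u ∷ʳ c) ≡ (v ⊕ u) ∷ʳ (b xor c)
⊕-∷ʳ []      []      b c = refl
⊕-∷ʳ (x ∷ v) (y ∷ u) b c = cong ((x xor y) ∷_) (⊕-∷ʳ v u b c)

∣lift∣ : ∀ {n} (v : Subset n) → ∣ lift v ∣ ≡ ∣ v ∣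
∣lift∣ []          = refl
∣lift∣ (true ∷ v)  = cong suc (∣lift∣ v)
∣lift∣ (false ∷ v) = ∣lift∣ v

∣lift-⊕-lift∣ : ∀ {n} (v u : Subset n) → ∣ lift v ⊕ lift u ∣ ≡ ∣ v ⊕ u ∣
∣lift-⊕-lift∣ v u = trans (cong ∣_∣ (⊕-∷ʳ v u false false)) (∣lift∣ (v ⊕ u))

⊥-lift : ∀ n → S.⊥ {suc n} ≡ lift (S.⊥ {n})
⊥-lift zero    = refl
⊥-lift (suc n) = cong (false ∷_) (⊥-lift n)

sumℤ-allVecs-∷ʳ : ∀ {A : Set} (xs : List A) n (g : Vec A (suc n) → ℤ) →
  sumℤ g (allVecs xs (suc n)) ≡ sumℤ (λ v → sumℤ (λ x → g (v ∷ʳ x)) xs) (allVecs xs n)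
sumℤ-allVecs-∷ʳ xs zero g = begin
  sumℤ g (concatMap (λ x → L.map (x ∷_) ([] ∷ [])) xs) ≡⟨ sumℤ-concatMap g _ xs ⟩
  sumℤ (λ x → g (x ∷ []) + 0ℤ) xs                      ≡⟨ sumℤ-cong xs (λ x → ℤP.+-identityʳ (g (x ∷ []))) ⟩
  sumℤ (λ x → g (x ∷ [])) xs                           ≡⟨ ℤP.+-identityʳ _ ⟨
  sumℤ (λ x → g (x ∷ [])) xs + 0ℤ                      ∎
  where open ≡-Reasoning
sumℤ-allVecs-∷ʳ xs (suc n) g = begin
  sumℤ g (concatMap (λ x → L.map (x ∷_) (allVecs xs (suc n))) xs)
    ≡⟨ sumℤ-concatMap g _ xs ⟩
  sumℤ (λ x → sumℤ g (L.map (x ∷_) (allVecs xs (suc n)))) xs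
    ≡⟨ sumℤ-cong xs (λ x → trans (sumℤ-map g (x ∷_) (allVecs xs (suc n)))
                                 (sumℤ-allVecs-∷ʳ xs n (g ∘ (x ∷_)))) ⟩
  sumℤ (λ x → sumℤ (H ∘ (x ∷_)) (allVecs xs n)) xs
    ≡⟨ sumℤ-cong xs (λ x → sumℤ-map H (x ∷_) (allVecs xs n)) ⟨
  sumℤ (λ x → sumℤ H (L.map (x ∷_) (allVecs xs n))) xs
    ≡⟨ sumℤ-concatMap H _ xs ⟨
  sumℤ H (concatMap (λ x → L.map (x ∷_) (allVecs xs n)) xs)
    ∎
  where
  open ≡-Reasoning
  H : Vec _ (suc n) → ℤ
  H v = sumℤ (λ x → g (v ∷ʳ x)) xs

sumℤ-allSubsets-δ : ∀ n (u : Subset n) (h : Subset n → ℤ) →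
  sumℤ (λ v → if v ==S u then h v else 0ℤ) (allSubsets n) ≡ h u
sumℤ-allSubsets-δ zero    [] h = ℤP.+-identityʳ (h [])
sumℤ-allSubsets-δ (suc n) (b ∷ u) h = begin
  sumℤ G (concatMap (λ x → L.map (x ∷_) (allSubsets n)) (true ∷ false ∷ []))
    ≡⟨ sumℤ-concatMap G (λ x → L.map (x ∷_) (allSubsets n)) (true ∷ false ∷ []) ⟩
  sumℤ (λ x → sumℤ G (L.map (x ∷_) (allSubsets n))) (true ∷ false ∷ [])
    ≡⟨ sumℤ-cong (true ∷ false ∷ []) (λ x → trans (sumℤ-map G (x ∷_) (allSubsets n)) (by-head x (x BP.≟ b))) ⟩
  sumℤ (λ x → if isYes (x BP.≟ b) then h (b ∷ u) else 0ℤ) (true ∷ false ∷ [])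
    ≡⟨ one-column b (h (b ∷ u)) ⟩
  h (b ∷ u)
    ∎
  where
  open ≡-Reasoning
  G : Subset (suc n) → ℤ
  G v = if v ==S (b ∷ u) then h v else 0ℤ
  by-head : ∀ x (x≟b : Dec (x ≡ b)) → sumℤ (G ∘ (x ∷_)) (allSubsets n) ≡ (if isYes x≟b then h (b ∷ u) else 0ℤ)
  by-head x (yes refl) = trans (sumℤ-cong (allSubsets n) (λ v → cong (if_then h (x ∷ v) else 0ℤ) (==S-∷ x v u)))
    (sumℤ-allSubsets-δ n u (h ∘ (x ∷_)))
  by-head x (no x≢b) = trans
    (sumℤ-cong (allSubsets n) (λ v → cong (if_then h (x ∷ v) else 0ℤ) (==S-≢ (x≢b ∘ VP.∷-injectiveˡ))))
    (sumℤ-zero (allSubsets n))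
  one-column : ∀ b' c → sumℤ (λ x → if isYes (x BP.≟ b') then c else 0ℤ) (true ∷ false ∷ []) ≡ c
  one-column true  c = trans (cong (c +_) (ℤP.+-identityʳ 0ℤ)) (ℤP.+-identityʳ c)
  one-column false c = trans (ℤP.+-identityˡ _) (ℤP.+-identityʳ c)

∁-∉-intersecting : ∀ {n} (ℱ : Family n) {A} → Intersecting ℱ → A ∈F ℱ → ℱ (∁ A) ≡ false
∁-∉-intersecting ℱ {A} intersecting A∈ℱ with ℱ (∁ A) in ∁A∈ℱ
... | false = refl
... | true  = let (x , x∈A∩∁A) = intersecting A (∁ A) A∈ℱ ∁A∈ℱ in
  contradiction (subst (x S.∈_) (SP.∩-inverseʳ A) x∈A∩∁A) SP.∉⊥

module FlowOf𝒢* {n} (ℱ : Family n) (A : Subset n) (A∈ℱ : A ∈F ℱ) (∁A∉ℱ : ℱ (∁ A) ≡ false) where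

  𝒢*-∷ʳ-true : ∀ v → (𝒢 ℱ A *) (v ∷ʳ true) ≡ ℱ (∁ v) ∧ not (∁ v ==S A)
  𝒢*-∷ʳ-true v
    rewrite VP.map-∷ʳ not true v | restrict-∷ʳ (∁ v) false | ==S-∷ʳ (∁ v) A false
          | VP.map-∷ʳ not false A | ==S-∷ʳ-≢ (∁ v) (∁ A) {false} {true} (λ ()) = BP.∨-identityʳ _

  𝒢*-lift : ∀ v → (𝒢 ℱ A *) (lift v) ≡ ℱ (∁ v) ∨ (∁ v ==S ∁ A)
  𝒢*-lift v
    rewrite VP.map-∷ʳ not false v | restrict-∷ʳ (∁ v) true | ==S-∷ʳ-≢ (∁ v) A {true} {false} (λ ())
          | VP.map-∷ʳ not false A | ==S-∷ʳ (∁ v) (∁ A) true = cong (_∨ (∁ v ==S ∁ A)) (BP.∧-identityʳ (ℱ (∁ v)))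

  A≢∁A : A ≢ ∁ A
  A≢∁A A≡∁A with () ← trans (sym A∈ℱ) (trans (cong ℱ A≡∁A) ∁A∉ℱ)

  -- Walks from v ∷ʳ true and lift v are opposite, so they cancel unless exactly one of the two sets
  -- lies in 𝒢*; this happens only for v = A and v = ∁ A.
  pair : ∀ v (w : ℤ) →
    (if (𝒢 ℱ A *) (v ∷ʳ true) then - w else 0ℤ) + (if (𝒢 ℱ A *) (lift v) then w else 0ℤ)
      ≡ (if v ==S A then w else 0ℤ) + (if v ==S ∁ A then w else 0ℤ)
  pair v w rewrite 𝒢*-∷ʳ-true v | 𝒢*-lift v = by-cases (VP.≡-dec BP._≟_ v A) (VP.≡-dec BP._≟_ v (∁ A))
    where
    by-cases : Dec (v ≡ A) → Dec (v ≡ ∁ A) →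
      (if ℱ (∁ v) ∧ not (∁ v ==S A) then - w else 0ℤ) + (if ℱ (∁ v) ∨ (∁ v ==S ∁ A) then w else 0ℤ)
        ≡ (if v ==S A then w else 0ℤ) + (if v ==S ∁ A then w else 0ℤ)
    by-cases (yes refl) _ rewrite ∁A∉ℱ | ==S-refl (∁ v) | ==S-refl v | ==S-≢ A≢∁A =
      trans (ℤP.+-identityˡ w) (sym (ℤP.+-identityʳ w))
    by-cases (no _) (yes refl) rewrite ∁-involutive A | A∈ℱ | ==S-refl A | ==S-refl (∁ A) | ==S-≢ (A≢∁A ∘ sym) =
      trans (ℤP.+-identityˡ w) (sym (ℤP.+-identityˡ w))
    by-cases (no v≢A) (no v≢∁A)
      rewrite ==S-≢ v≢A | ==S-≢ v≢∁A
            | ==S-≢ {X = ∁ v} {A} (λ e → v≢∁A (trans (sym (∁-involutive v)) (cong ∁ e)))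
            | ==S-≢ {X = ∁ v} {∁ A} (λ e → v≢A (trans (sym (∁-involutive v)) (trans (cong ∁ e) (∁-involutive A))))
      = cancel (ℱ (∁ v))
      where
      cancel : ∀ b → (if b ∧ true then - w else 0ℤ) + (if b ∨ false then w else 0ℤ) ≡ 0ℤ
      cancel true  = ℤP.+-inverseˡ w
      cancel false = refl

  walk-∷ʳ-true : ∀ (Y : Subset (suc n)) {l} (σ : Vec (Fin (suc n)) l) v →
    walk Y (Flow.Z Y (fromℕ n)) (v ∷ʳ true) σ ≡ - walk Y (Flow.Z Y (fromℕ n)) (lift v) σ
  walk-∷ʳ-true Y σ v = trans (cong (λ X → walk Y (Flow.Z Y (fromℕ n)) X σ) (sym (toggle-last v)))
                             (Flow.walk-toggle-a Y (fromℕ n) σ (lift v))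

  walks-𝒢* : ∀ (Y : Subset (suc n)) {l} (σ : Vec (Fin (suc n)) l) →
    let w = λ v → walk Y (Flow.Z Y (fromℕ n)) (lift v) σ in
    sumℤ (λ X → if (𝒢 ℱ A *) X then walk Y (Flow.Z Y (fromℕ n)) X σ else 0ℤ) (allSubsets (suc n)) ≡ w A + w (∁ A)
  walks-𝒢* Y σ = begin
    sumℤ g (allSubsets (suc n))
      ≡⟨ sumℤ-allVecs-∷ʳ (true ∷ false ∷ []) n g ⟩
    sumℤ (λ v → g (v ∷ʳ true) + (g (lift v) + 0ℤ)) (allSubsets n)
      ≡⟨ sumℤ-cong (allSubsets n) (λ v → trans (signs v) (pair v (w v))) ⟩
    sumℤ (λ v → (if v ==S A then w v else 0ℤ) + (if v ==S ∁ A then w v else 0ℤ)) (allSubsets n)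
      ≡⟨ sumℤ-+ (λ v → if v ==S A then w v else 0ℤ) (λ v → if v ==S ∁ A then w v else 0ℤ) (allSubsets n) ⟩
    sumℤ (λ v → if v ==S A then w v else 0ℤ) (allSubsets n) + sumℤ (λ v → if v ==S ∁ A then w v else 0ℤ) (allSubsets n)
      ≡⟨ cong₂ _+_ (sumℤ-allSubsets-δ n A w) (sumℤ-allSubsets-δ n (∁ A) w) ⟩
    w A + w (∁ A)
      ∎
    where
    open ≡-Reasoning
    Z : Subset (suc n)
    Z = Flow.Z Y (fromℕ n)
    g : Subset (suc n) → ℤ
    g X = if (𝒢 ℱ A *) X then walk Y Z X σ else 0ℤ
    w : Subset n → ℤ
    w v = walk Y Z (lift v) σ
    signs : ∀ v → g (v ∷ʳ true) + (g (lift v) + 0ℤ)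
                ≡ (if (𝒢 ℱ A *) (v ∷ʳ true) then - w v else 0ℤ) + (if (𝒢 ℱ A *) (lift v) then w v else 0ℤ)
    signs v = cong₂ _+_ (cong (if (𝒢 ℱ A *) (v ∷ʳ true) then_else 0ℤ) (walk-∷ʳ-true Y σ v)) (ℤP.+-identityʳ _)

  Λ-𝒢* : ∀ Y →
    Λ (𝒢 ℱ A *) (lift Y) (lift Y ∪ ⁅ fromℕ n ⁆) ≡ ⁺ (weight n ∣ A ⊕ Y ∣ ℕ.+ weight n ∣ A ⊕ Y ∣)
  Λ-𝒢* Y = begin
    Λ (𝒢 ℱ A *) (lift Y) Z
      ≡⟨ sumℤ-cong (Perms (suc n)) (walks-𝒢* (lift Y)) ⟩
    sumℤ (λ σ → walk (lift Y) Z (lift A) σ + walk (lift Y) Z (lift (∁ A)) σ) (Perms (suc n))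
      ≡⟨ sumℤ-+ (walk (lift Y) Z (lift A)) (walk (lift Y) Z (lift (∁ A))) (Perms (suc n)) ⟩
    sumℤ (walk (lift Y) Z (lift A)) (Perms (suc n)) + sumℤ (walk (lift Y) Z (lift (∁ A))) (Perms (suc n))
      ≡⟨ cong₂ _+_ (sumℤ-walk-Perms (lift Y) (fromℕ n) (lookup-last Y false) (lift A) (lookup-last A false))
                   (sumℤ-walk-Perms (lift Y) (fromℕ n) (lookup-last Y false) (lift (∁ A)) (lookup-last (∁ A) false)) ⟩
    ⁺ (weight n ∣ lift A ⊕ lift Y ∣) + ⁺ (weight n ∣ lift (∁ A) ⊕ lift Y ∣)
      ≡⟨ cong₂ (λ i j → ⁺ (weight n i) + ⁺ (weight n j)) (∣lift-⊕-lift∣ A Y) distance-∁A ⟩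
    ⁺ (weight n ∣ A ⊕ Y ∣) + ⁺ (weight n (n ∸ ∣ A ⊕ Y ∣))
      ≡⟨ cong (λ t → ⁺ (weight n ∣ A ⊕ Y ∣) + ⁺ t) (weight-sym n ∣ A ⊕ Y ∣ (SP.∣p∣≤n (A ⊕ Y))) ⟩
    ⁺ (weight n ∣ A ⊕ Y ∣) + ⁺ (weight n ∣ A ⊕ Y ∣)
      ≡⟨ ℤP.pos-+ (weight n ∣ A ⊕ Y ∣) (weight n ∣ A ⊕ Y ∣) ⟨
    ⁺ (weight n ∣ A ⊕ Y ∣ ℕ.+ weight n ∣ A ⊕ Y ∣)
      ∎
    where
    open ≡-Reasoning
    Z : Subset (suc n)
    Z = lift Y ∪ ⁅ fromℕ n ⁆
    distance-∁A : ∣ lift (∁ A) ⊕ lift Y ∣ ≡ n ∸ ∣ A ⊕ Y ∣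
    distance-∁A = trans (∣lift-⊕-lift∣ (∁ A) Y) (trans (cong ∣_∣ (∁-⊕ A Y)) (SP.∣∁p∣≡n∸∣p∣ (A ⊕ Y)))

  Λ-𝒢*-∅ : Λ (𝒢 ℱ A *) S.⊥ ⁅ fromℕ n ⁆ ≡ ⁺ (weight n ∣ A ∣ ℕ.+ weight n ∣ A ∣)
  Λ-𝒢*-∅ = begin
    Λ (𝒢 ℱ A *) S.⊥ ⁅ fromℕ n ⁆
      ≡⟨ cong₂ (Λ (𝒢 ℱ A *)) (⊥-lift n)
               (trans (sym (SP.∪-identityˡ ⁅ fromℕ n ⁆)) (cong (_∪ ⁅ fromℕ n ⁆) (⊥-lift n))) ⟩
    Λ (𝒢 ℱ A *) (lift S.⊥) (lift S.⊥ ∪ ⁅ fromℕ n ⁆)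
      ≡⟨ Λ-𝒢* S.⊥ ⟩
    ⁺ (weight n ∣ A ⊕ S.⊥ ∣ ℕ.+ weight n ∣ A ⊕ S.⊥ ∣)
      ≡⟨ cong (λ X → ⁺ (weight n ∣ X ∣ ℕ.+ weight n ∣ X ∣)) (⊕-⊥ A) ⟩
    ⁺ (weight n ∣ A ∣ ℕ.+ weight n ∣ A ∣)
      ∎
    where open ≡-Reasoning

  Λ-𝒢*-at-distance : ∀ k → k ℕ.≤ n → Σ (Subset (suc n)) λ B →
    fromℕ n S.∉ B × Λ (𝒢 ℱ A *) B (B ∪ ⁅ fromℕ n ⁆) ≡ ⁺ (weight n k ℕ.+ weight n k)
  Λ-𝒢*-at-distance k k≤n = lift (A ⊕ D) , last∉ , trans (Λ-𝒢* (A ⊕ D))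
    (cong (λ j → ⁺ (weight n j ℕ.+ weight n j)) (trans (cong ∣_∣ (⊕-cancelˡ A D)) ∣D∣≡k))
    where
    D : Subset n
    D = proj₁ (subset-of-size n k k≤n)
    ∣D∣≡k : ∣ D ∣ ≡ k
    ∣D∣≡k = proj₂ (subset-of-size n k k≤n)
    last∉ : fromℕ n S.∉ lift (A ⊕ D)
    last∉ last∈ with () ← trans (sym (VP.[]=⇒lookup last∈)) (lookup-last (A ⊕ D) false)

halves-SetEq₂ : ∀ n k → k ≡ ⌊ n /2⌋ ⊎ k ≡ ⌈ n /2⌉ → SetEq₂ k (n ∸ k) ⌊ n /2⌋ ⌈ n /2⌉
halves-SetEq₂ n k (inj₁ refl) =
  (inj₁ refl , inj₂ (n∸⌊n/2⌋≡⌈n/2⌉ n)) , (inj₁ refl , inj₂ (sym (n∸⌊n/2⌋≡⌈n/2⌉ n)))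
halves-SetEq₂ n k (inj₂ refl) =
  (inj₂ refl , inj₁ (n∸⌈n/2⌉≡⌊n/2⌋ n)) , (inj₂ (sym (n∸⌈n/2⌉≡⌊n/2⌋ n)) , inj₁ refl)

mainTheorem9 : (n : ℕ) (ℱ : Family n) (A : Subset n)
    → MaximalIntersecting ℱ
    → InclusionMinimalIn A ℱ
    → ¬ SetEq₂ ∣ A ∣ (n ∸ ∣ A ∣) ⌊ n /2⌋ ⌈ n /2⌉
    → ¬ ∅-minimal (𝒢 ℱ A)
mainTheorem9 n ℱ A (intersecting , _) (A∈ℱ , _) unbalanced ∅-minimal-𝒢 =
  ℕP.<⇒≱ (ℕP.+-mono-< balanced<A balanced<A) (ℤP.drop‿+≤+ Λ-∅≤Λ-B)
  where
  open FlowOf𝒢* ℱ A A∈ℱ (∁-∉-intersecting ℱ intersecting A∈ℱ)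
  balanced<A : weight n ⌊ n /2⌋ ℕ.< weight n ∣ A ∣
  balanced<A = weight-minimum n ∣ A ∣ (SP.∣p∣≤n A)
    (unbalanced ∘ halves-SetEq₂ n ∣ A ∣ ∘ inj₁) (unbalanced ∘ halves-SetEq₂ n ∣ A ∣ ∘ inj₂)
  Λ-∅≤Λ-B : ⁺ (weight n ∣ A ∣ ℕ.+ weight n ∣ A ∣) ℤ.≤ ⁺ (weight n ⌊ n /2⌋ ℕ.+ weight n ⌊ n /2⌋)
  Λ-∅≤Λ-B with Λ-𝒢*-at-distance ⌊ n /2⌋ (ℕP.⌊n/2⌋≤n n)
  ... | B , last∉B , Λ-B = subst₂ ℤ._≤_ Λ-𝒢*-∅ Λ-B (proj₂ (∅-minimal-𝒢 (fromℕ n)) B last∉B)
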